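{- Let $\varphi\in\mathsf{LTL_f}(\mathcal{P})$ with $\mathcal{P}=\mathcal{P}_o\uplus\mathcal{P}_u$, and let $\mathcal{S}$ be the state set of the belief-state DFA $\mathcal{A}^B_\varphi$ of $\varphi$. Then $\mathcal{S}$ is finite and $|\mathcal{S}|=O(2^{2^{n}})$, where $n=|\mathsf{sf}(\varphi)|$ is the number of subformulas of $\varphi$.
   Context: $\mathbb{B}=\{\bot,\top\}$; assignments $w:\mathcal{P}\to\mathbb{B}$ (identified with the set of true propositions); $w|_{\mathcal{P}_o}$ is restriction. $\mathsf{LTL_f}(\mathcal{P})$ formulas: $\varphi::=\mathit{tt}\mid\mathit{ff}\mid p\mid\neg\varphi\mid\varphi\odot\varphi\mid \mathsf{X}\varphi\mid\mathsf{X}^{s}\varphi\mid\mathsf{F}\varphi\mid\mathsf{G}\varphi\mid\varphi\,\mathsf{U}\,\varphi\mid\varphi\,\mathsf{R}\,\varphi$ ($\odot$ a binary Boolean connective). $\mathsf{sf}(\varphi)$ is the set of subformulas of $\varphi$. Propositional equivalence $\sim$: replace each maximal temporal subformula $\psi$ (one whose main operator is temporal and not strictly inside another temporal subformula) by a fresh Boolean variable $x_\psi$; two formulas are $\sim$-equivalent iff the resulting Boolean formulas are semantically equivalent. $[\varphi]_\sim$ is a fixed unique representative of the $\sim$-class. Pairs: $(\varphi_1,b_1)\odot(\varphi_2,b_2)=([\varphi_1\odot\varphi_2]_\sim,b_1\odot b_2)$, $\neg(\varphi,b)=([\neg\varphi]_\sim,\neg b)$, $\bigwedge X=(\bigwedge_{(\varphi,b)\in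 X}\varphi,\bigwedge_{(\varphi,b)\in X}b)$. Formula progression $\mathrm{fp}(\varphi,w)$: $\mathrm{fp}(\mathit{tt},w)=(\mathit{tt},\top)$, $\mathrm{fp}(\mathit{ff},w)=(\mathit{ff},\bot)$; $\mathrm{fp}(p,w)=(\mathit{tt},\top)$ if $p\in w$, else $(\mathit{ff},\bot)$; $\mathrm{fp}(\neg\varphi,w)=\neg\mathrm{fp}(\varphi,w)$; $\mathrm{fp}(\varphi_1\odot\varphi_2,w)=\mathrm{fp}(\varphi_1,w)\odot\mathrm{fp}(\varphi_2,w)$; $\mathrm{fp}(\mathsf{X}\varphi,w)=(\varphi,\top)$; $\mathrm{fp}(\mathsf{X}^s\varphi,w)=(\varphi,\bot)$; $\mathrm{fp}(\mathsf{F}\varphi,w)=\mathrm{fp}(\varphi,w)\vee(\mathsf{F}\varphi,\bot)$; $\mathrm{fp}(\mathsf{G}\varphi,w)=\mathrm{fp}(\varphi,w)\wedge(\mathsf{G}\varphi,\top)$; $\mathrm{fp}(\varphi_1\mathsf{U}\varphi_2,w)=\mathrm{fp}(\varphi_2,w)\vee(\mathrm{fp}(\varphi_1,w)\wedge(\varphi_1\mathsf{U}\varphi_2,\bot))$; $\mathrm{fp}(\varphi_1\mathsf{R}\varphi_2,w)=\mathrm{fp}(\varphi_2,w)\wedge(\mathrm{fp}(\varphi_1,w)\vee(\varphi_1\mathsf{R}\varphi_2,\top))$. Observable progression: $\mathrm{fp}_{\mathrm{obs}}(\psi,w_o)=\bigwedge\{\mathrm{fp}(\psi,w)\mid w\in\mathbb{B}^{\mathcal{P}},\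 w|_{\mathcal{P}_o}=w_o\}$ for $w_o\in\mathbb{B}^{\mathcal{P}_o}$, extended to nonempty words $\sigma_o\in(\mathbb{B}^{\mathcal{P}_o})^+$ by iterating on the first component. The state set of the belief-state DFA is $\mathcal{S}=\{[\varphi]_\sim\}\cup\{[\psi']_\sim\mid(\psi',\_)=\mathrm{fp}_{\mathrm{obs}}(\varphi,\sigma_o),\ \sigma_o\in(\mathbb{B}^{\mathcal{P}_o})^+\}$. -}

module Defs where

open import Data.Bool using (Bool; true; false; _∧_; not; if_then_else_)
open import Data.Nat using (ℕ; zero; suc)
open import Data.Fin using (Fin; zero; suc)
import Data.Fin as Fin
open import Data.Sum using (_⊎_; inj₁; inj₂; [_,_])
open import Data.Sum.Properties using (≡-dec)
open import Data.Product using (_×_; _,_; proj₁; proj₂; ∃-syntax)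
open import Data.List using (List; []; _∷_; map; concatMap; deduplicateᵇ; length)
open import Relation.Nullary.Decidable using (⌊_⌋)
open import Relation.Binary.PropositionalEquality using (_≡_)

data BinOp : Set where
  op : (a b c d : Bool) → BinOp

⟦_⟧op : BinOp → Bool → Bool → Bool
⟦ op a b c d ⟧op true  true  = a
⟦ op a b c d ⟧op true  false = b
⟦ op a b c d ⟧op false true  = c
⟦ op a b c d ⟧op false false = d

andOp : BinOp
andOp = op true false false false

orOp : BinOp
orOp = op true true true false

eqBool : Bool → Bool → Bool
eqBool true  true  = true
eqBool false false = true
eqBool _     _     = false

eqOp : BinOp → BinOp → Bool
eqOp (op a b c d) (op a' b' c' d') =
  eqBool a a' ∧ eqBool b b' ∧ eqBool c c' ∧ eqBool d d'

data Formula (P : Set) : Set where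
  tt ff : Formula P
  prop  : P → Formula P
  neg   : Formula P → Formula P
  bin   : BinOp → Formula P → Formula P → Formula P
  X Xs F G : Formula P → Formula P
  U R   : Formula P → Formula P → Formula P

-- Propositions P = P_o ⊎ P_u with |P_o| = ko, |P_u| = ku
Prop : ℕ → ℕ → Set
Prop ko ku = Fin ko ⊎ Fin ku

-- Propositional equivalence ~ : maximal temporal subformulas are treated
-- as Boolean variables (one variable per syntactically distinct temporal
-- formula, valuation vt), propositions as Boolean variables (valuation vp).

evalB : {P : Set} → (P → Bool) → (Formula P → Bool) → Formula P → Bool
evalB vp vt tt          = true
evalB vp vt ff          = false
evalB vp vt (prop p)    = vp p
evalB vp vt (neg φ)     = not (evalB vp vt φ)
evalB vp vt (bin o φ ψ) = ⟦ o ⟧op (evalB vp vt φ) (evalB vp vt ψ)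
evalB vp vt (X φ)       = vt (X φ)
evalB vp vt (Xs φ)      = vt (Xs φ)
evalB vp vt (F φ)       = vt (F φ)
evalB vp vt (G φ)       = vt (G φ)
evalB vp vt (U φ ψ)     = vt (U φ ψ)
evalB vp vt (R φ ψ)     = vt (R φ ψ)

_∼_ : {P : Set} → Formula P → Formula P → Set
φ ∼ ψ = ∀ vp vt → evalB vp vt φ ≡ evalB vp vt ψ

record IsRep {P : Set} (rep : Formula P → Formula P) : Set₁ where
  field
    rep-∼      : ∀ φ → rep φ ∼ φ
    rep-unique : ∀ φ ψ → φ ∼ ψ → rep φ ≡ rep ψ

Pair : Set → Set
Pair P = Formula P × Bool

module Prog {P : Set} (rep : Formula P → Formula P) where

  binP : BinOp → Pair P → Pair P → Pair P
  binP o (φ₁ , b₁) (φ₂ , b₂) = rep (bin o φ₁ φ₂) , ⟦ o ⟧op b₁ b₂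

  negP : Pair P → Pair P
  negP (φ , b) = rep (neg φ) , not b

  _∧P_ _∨P_ : Pair P → Pair P → Pair P
  x ∧P y = binP andOp x y
  x ∨P y = binP orOp x y

  fp : Formula P → (P → Bool) → Pair P
  fp tt w          = tt , true
  fp ff w          = ff , false
  fp (prop p) w    = if w p then (tt , true) else (ff , false)
  fp (neg φ) w     = negP (fp φ w)
  fp (bin o φ ψ) w = binP o (fp φ w) (fp ψ w)
  fp (X φ) w       = φ , true
  fp (Xs φ) w      = φ , false
  fp (F φ) w       = fp φ w ∨P (F φ , false)
  fp (G φ) w       = fp φ w ∧P (G φ , true)
  fp (U φ ψ) w     = fp ψ w ∨P (fp φ w ∧P (U φ ψ , false))
  fp (R φ ψ) w     = fp ψ w ∧P (fp φ w ∨P (R φ ψ , true))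

  bigAnd : List (Pair P) → Pair P
  bigAnd []                = tt , true
  bigAnd ((φ , b) ∷ [])    = φ , b
  bigAnd ((φ , b) ∷ x ∷ xs) with bigAnd (x ∷ xs)
  ... | (ψ , c) = bin andOp φ ψ , b ∧ c

allAssign : (m : ℕ) → List (Fin m → Bool)
allAssign zero    = (λ ()) ∷ []
allAssign (suc m) =
  concatMap (λ f → (λ { zero → true  ; (suc i) → f i })
                 ∷ (λ { zero → false ; (suc i) → f i }) ∷ [])
            (allAssign m)

module Obs {ko ku : ℕ} (rep : Formula (Prop ko ku) → Formula (Prop ko ku)) where
  open Prog rep

  -- fp_obs(ψ, w_o) = ⋀ { fp(ψ,w) | w|_{P_o} = w_o }; such w are exactly [ w_o , w_u ]
  fpObs : Formula (Prop ko ku) → (Fin ko → Bool) → Pair (Prop ko ku)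
  fpObs ψ wo = bigAnd (map (λ wu → fp ψ [ wo , wu ]) (allAssign ku))

  -- extension to nonempty observation words a σ, iterating on the first component
  fpObsW : Formula (Prop ko ku) → (Fin ko → Bool) → List (Fin ko → Bool) → Pair (Prop ko ku)
  fpObsW ψ a []      = fpObs ψ a
  fpObsW ψ a (b ∷ σ) = fpObsW (proj₁ (fpObs ψ a)) b σ

  InS : Formula (Prop ko ku) → Formula (Prop ko ku) → Set
  InS φ s = (s ≡ rep φ)
          ⊎ (∃[ a ] ∃[ σ ] (s ≡ rep (proj₁ (fpObsW φ a σ))))

sfList : {P : Set} → Formula P → List (Formula P)
sfList tt            = tt ∷ []
sfList ff            = ff ∷ []
sfList (prop p)      = prop p ∷ []
sfList φ@(neg ψ)     = φ ∷ sfList ψ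
sfList φ@(bin o ψ χ) = φ ∷ (sfList ψ Data.List.++ sfList χ)
sfList φ@(X ψ)       = φ ∷ sfList ψ
sfList φ@(Xs ψ)      = φ ∷ sfList ψ
sfList φ@(F ψ)       = φ ∷ sfList ψ
sfList φ@(G ψ)       = φ ∷ sfList ψ
sfList φ@(U ψ χ)     = φ ∷ (sfList ψ Data.List.++ sfList χ)
sfList φ@(R ψ χ)     = φ ∷ (sfList ψ Data.List.++ sfList χ)

eqF : {P : Set} → (P → P → Bool) → Formula P → Formula P → Bool
eqF e tt tt                   = true
eqF e ff ff                   = true
eqF e (prop p) (prop q)       = e p q
eqF e (neg φ) (neg ψ)         = eqF e φ ψ
eqF e (bin o φ ψ) (bin o' φ' ψ') = eqOp o o' ∧ eqF e φ φ' ∧ eqF e ψ ψ'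
eqF e (X φ) (X ψ)             = eqF e φ ψ
eqF e (Xs φ) (Xs ψ)           = eqF e φ ψ
eqF e (F φ) (F ψ)             = eqF e φ ψ
eqF e (G φ) (G ψ)             = eqF e φ ψ
eqF e (U φ ψ) (U φ' ψ')       = eqF e φ φ' ∧ eqF e ψ ψ'
eqF e (R φ ψ) (R φ' ψ')       = eqF e φ φ' ∧ eqF e ψ ψ'
eqF e _ _                     = false

eqProp : {ko ku : ℕ} → Prop ko ku → Prop ko ku → Bool
eqProp p q = ⌊ ≡-dec Fin._≟_ Fin._≟_ p q ⌋

nsf : {ko ku : ℕ} → Formula (Prop ko ku) → ℕ
nsf φ = length (deduplicateᵇ (eqF eqProp) (sfList φ))

{-# OPTIONS --safe #-}
module Submission where

-- Fix the vector D of distinct subformulas of φ and call a formula D-determined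
-- if its propositional value (temporal subformulas read as atoms) is a Boolean
-- function of the values of the formulas in D. Progressing ψ by w substitutes
-- w for the propositions and fp T w for each temporal subformula T of ψ; for
-- T ∈ sf(φ) the formula fp T w is a Boolean combination of subformulas of φ.
-- Hence progression, conjunction over the unobservable assignments and the
-- choice of ∼-representatives all preserve D-determinedness, and φ itself is
-- D-determined. A D-determined formula is ∼-equivalent to the formula of its
-- truth table over D, so every state is the representative of one of the
-- 2^(2^n) truth-table formulas.

open import Defs
open import Data.Nat using (ℕ; _≤_; _*_; _^_)
open import Data.Product using (_×_; ∃-syntax)
open import Data.List using (List; length)
open import Data.List.Membership.Propositional using (_∈_)

open import Data.Bool using (Bool; true; false; not; _∧_; T; if_then_else_)
open import Data.Bool.Properties using (T-∧)
open import Data.Nat using (zero; suc; _+_)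
open import Data.Nat.Properties using (^-distribˡ-+-*; +-identityʳ; *-identityˡ; ≤-reflexive)
open import Data.Product using (_,_; proj₁)
open import Data.Sum using (inj₁; inj₂; [_,_])
open import Data.List using ([]; _∷_; map; _++_; cartesianProduct; deduplicateᵇ)
open import Data.List.Properties using (length-++; length-map)
open import Data.List.Relation.Unary.All using (All; []; _∷_; universal)
import Data.List.Relation.Unary.All as All
open import Data.List.Relation.Unary.All.Properties using (map⁺; ++⁻ˡ; ++⁻ʳ)
open import Data.List.Relation.Unary.Any using (here; there)
open import Data.List.Membership.Propositional.Properties
  using (∈-++⁻; ∈-++⁺ˡ; ∈-++⁺ʳ; ∈-map⁺; ∈-cartesianProduct⁺; ∈-deduplicate⁻)
import Data.List.Membership.Setoid.Properties as SetoidMembership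
open import Data.Vec using (Vec; []; _∷_; lookup; tabulate; fromList)
open import Data.Vec.Properties using (lookup∘tabulate; tabulate-cong)
open import Data.Vec.Membership.Propositional using () renaming (_∈_ to _∈ᵥ_)
open import Data.Vec.Membership.Propositional.Properties using (∈-lookup; ∈-fromList⁺; ∈-fromList⁻)
import Data.Vec.Relation.Unary.Any as VecAny
open import Data.Vec.Relation.Unary.Any.Properties using (lookup-index)
open import Function using (_∘_; Equivalence)
open import Relation.Nullary.Decidable using (toWitness; T?)
open import Relation.Binary.PropositionalEquality hiding ([_])
open ≡-Reasoning

T-∧⁻ : ∀ {x y} → T (x ∧ y) → T x × T y
T-∧⁻ {x} = Equivalence.to (T-∧ {x})

eqBool-sound : ∀ a b → T (eqBool a b) → a ≡ b
eqBool-sound true  true  _ = refl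
eqBool-sound false false _ = refl

eqOp-sound : ∀ o o' → T (eqOp o o') → o ≡ o'
eqOp-sound (op a b c d) (op a' b' c' d') h
  with ha , h ← T-∧⁻ {eqBool a a'} h
  with hb , h ← T-∧⁻ {eqBool b b'} h
  with hc , hd ← T-∧⁻ {eqBool c c'} h
  rewrite eqBool-sound a a' ha | eqBool-sound b b' hb
        | eqBool-sound c c' hc | eqBool-sound d d' hd = refl

eqF-sound : {P : Set} {e : P → P → Bool} → (∀ p q → T (e p q) → p ≡ q) →
            ∀ x y → T (eqF e x y) → x ≡ y
eqF-sound e-sound tt tt _ = refl
eqF-sound e-sound ff ff _ = refl
eqF-sound e-sound (prop p) (prop q) h = cong prop (e-sound p q h)
eqF-sound e-sound (neg x) (neg y) h = cong neg (eqF-sound e-sound x y h)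
eqF-sound e-sound (bin o x y) (bin o' x' y') h
  with ho , h ← T-∧⁻ {eqOp o o'} h
  with hx , hy ← T-∧⁻ {eqF _ x x'} h
  rewrite eqOp-sound o o' ho | eqF-sound e-sound x x' hx | eqF-sound e-sound y y' hy = refl
eqF-sound e-sound (X x) (X y) h = cong X (eqF-sound e-sound x y h)
eqF-sound e-sound (Xs x) (Xs y) h = cong Xs (eqF-sound e-sound x y h)
eqF-sound e-sound (F x) (F y) h = cong F (eqF-sound e-sound x y h)
eqF-sound e-sound (G x) (G y) h = cong G (eqF-sound e-sound x y h)
eqF-sound e-sound (U x y) (U x' y') h
  with hx , hy ← T-∧⁻ {eqF _ x x'} h =
  cong₂ U (eqF-sound e-sound x x' hx) (eqF-sound e-sound y y' hy)
eqF-sound e-sound (R x y) (R x' y') h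
  with hx , hy ← T-∧⁻ {eqF _ x x'} h =
  cong₂ R (eqF-sound e-sound x x' hx) (eqF-sound e-sound y y' hy)

sfList-self : {P : Set} (ψ : Formula P) → ψ ∈ sfList ψ
sfList-self tt          = here refl
sfList-self ff          = here refl
sfList-self (prop p)    = here refl
sfList-self (neg ψ)     = here refl
sfList-self (bin o ψ χ) = here refl
sfList-self (X ψ)       = here refl
sfList-self (Xs ψ)      = here refl
sfList-self (F ψ)       = here refl
sfList-self (G ψ)       = here refl
sfList-self (U ψ χ)     = here refl
sfList-self (R ψ χ)     = here refl

sfList-trans : {P : Set} (φ : Formula P) {ψ χ : Formula P} →
               ψ ∈ sfList φ → χ ∈ sfList ψ → χ ∈ sfList φ
sfList-trans₂ : {P : Set} (φ φ' : Formula P) {ψ χ : Formula P} →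
                ψ ∈ sfList φ ++ sfList φ' → χ ∈ sfList ψ → χ ∈ sfList φ ++ sfList φ'

sfList-trans tt          (here refl) χ∈ψ = χ∈ψ
sfList-trans ff          (here refl) χ∈ψ = χ∈ψ
sfList-trans (prop p)    (here refl) χ∈ψ = χ∈ψ
sfList-trans (neg φ)     (here refl) χ∈ψ = χ∈ψ
sfList-trans (bin o φ φ') (here refl) χ∈ψ = χ∈ψ
sfList-trans (X φ)       (here refl) χ∈ψ = χ∈ψ
sfList-trans (Xs φ)      (here refl) χ∈ψ = χ∈ψ
sfList-trans (F φ)       (here refl) χ∈ψ = χ∈ψ
sfList-trans (G φ)       (here refl) χ∈ψ = χ∈ψ
sfList-trans (U φ φ')    (here refl) χ∈ψ = χ∈ψ
sfList-trans (R φ φ')    (here refl) χ∈ψ = χ∈ψ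
sfList-trans (neg φ)     (there ψ∈φ) χ∈ψ = there (sfList-trans φ ψ∈φ χ∈ψ)
sfList-trans (bin o φ φ') (there ψ∈φ) χ∈ψ = there (sfList-trans₂ φ φ' ψ∈φ χ∈ψ)
sfList-trans (X φ)       (there ψ∈φ) χ∈ψ = there (sfList-trans φ ψ∈φ χ∈ψ)
sfList-trans (Xs φ)      (there ψ∈φ) χ∈ψ = there (sfList-trans φ ψ∈φ χ∈ψ)
sfList-trans (F φ)       (there ψ∈φ) χ∈ψ = there (sfList-trans φ ψ∈φ χ∈ψ)
sfList-trans (G φ)       (there ψ∈φ) χ∈ψ = there (sfList-trans φ ψ∈φ χ∈ψ)
sfList-trans (U φ φ')    (there ψ∈φ) χ∈ψ = there (sfList-trans₂ φ φ' ψ∈φ χ∈ψ)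
sfList-trans (R φ φ')    (there ψ∈φ) χ∈ψ = there (sfList-trans₂ φ φ' ψ∈φ χ∈ψ)

sfList-trans₂ φ φ' ψ∈φφ' χ∈ψ =
  [ (λ ψ∈φ → ∈-++⁺ˡ (sfList-trans φ ψ∈φ χ∈ψ))
  , (λ ψ∈φ' → ∈-++⁺ʳ (sfList φ) (sfList-trans φ' ψ∈φ' χ∈ψ))
  ] (∈-++⁻ (sfList φ) ψ∈φφ')

TruthTable : ℕ → Set
TruthTable zero    = Bool
TruthTable (suc n) = TruthTable n × TruthTable n

evalTT : ∀ {n} → TruthTable n → Vec Bool n → Bool
evalTT {zero}  b         []      = b
evalTT {suc n} (t₁ , t₂) (x ∷ v) = if x then evalTT t₁ v else evalTT t₂ v

truthTable : ∀ {n} → (Vec Bool n → Bool) → TruthTable n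
truthTable {zero}  g = g []
truthTable {suc n} g = truthTable (g ∘ (true ∷_)) , truthTable (g ∘ (false ∷_))

evalTT-truthTable : ∀ {n} (g : Vec Bool n → Bool) v → evalTT (truthTable g) v ≡ g v
evalTT-truthTable g []          = refl
evalTT-truthTable g (true ∷ v)  = evalTT-truthTable (g ∘ (true ∷_)) v
evalTT-truthTable g (false ∷ v) = evalTT-truthTable (g ∘ (false ∷_)) v

allTruthTables : ∀ n → List (TruthTable n)
allTruthTables zero    = true ∷ false ∷ []
allTruthTables (suc n) = cartesianProduct (allTruthTables n) (allTruthTables n)

∈-allTruthTables : ∀ {n} (t : TruthTable n) → t ∈ allTruthTables n
∈-allTruthTables {zero}  true      = here refl
∈-allTruthTables {zero}  false     = there (here refl)
∈-allTruthTables {suc n} (t₁ , t₂) =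
  ∈-cartesianProduct⁺ (∈-allTruthTables t₁) (∈-allTruthTables t₂)

length-cartesianProduct : {A B : Set} (xs : List A) (ys : List B) →
                          length (cartesianProduct xs ys) ≡ length xs * length ys
length-cartesianProduct []       ys = refl
length-cartesianProduct (x ∷ xs) ys = begin
  length (map (x ,_) ys ++ cartesianProduct xs ys)
    ≡⟨ length-++ (map (x ,_) ys) ⟩
  length (map (x ,_) ys) + length (cartesianProduct xs ys)
    ≡⟨ cong₂ _+_ (length-map (x ,_) ys) (length-cartesianProduct xs ys) ⟩
  length ys + length xs * length ys ∎

length-allTruthTables : ∀ n → length (allTruthTables n) ≡ 2 ^ 2 ^ n
length-allTruthTables zero    = refl
length-allTruthTables (suc n) = begin
  length (cartesianProduct (allTruthTables n) (allTruthTables n))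
    ≡⟨ length-cartesianProduct (allTruthTables n) (allTruthTables n) ⟩
  length (allTruthTables n) * length (allTruthTables n)
    ≡⟨ cong₂ _*_ (length-allTruthTables n) (length-allTruthTables n) ⟩
  2 ^ 2 ^ n * 2 ^ 2 ^ n
    ≡⟨ ^-distribˡ-+-* 2 (2 ^ n) (2 ^ n) ⟨
  2 ^ (2 ^ n + 2 ^ n)
    ≡⟨ cong (λ k → 2 ^ (2 ^ n + k)) (+-identityʳ (2 ^ n)) ⟨
  2 ^ 2 ^ suc n ∎

valuation : {P : Set} {n : ℕ} → Vec (Formula P) n → (P → Bool) → (Formula P → Bool) → Vec Bool n
valuation D vp vt = tabulate (evalB vp vt ∘ lookup D)

record Determined {P : Set} {n : ℕ} (D : Vec (Formula P) n) (x : Formula P) : Set where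
  constructor determinedBy
  field
    truthFunction : Vec Bool n → Bool
    evalB≡        : ∀ vp vt → evalB vp vt x ≡ truthFunction (valuation D vp vt)

module _ {P : Set} {n : ℕ} {D : Vec (Formula P) n} where

  tt-determined : Determined D tt
  tt-determined = determinedBy (λ _ → true) (λ _ _ → refl)

  ff-determined : Determined D ff
  ff-determined = determinedBy (λ _ → false) (λ _ _ → refl)

  neg-determined : ∀ {x} → Determined D x → Determined D (neg x)
  neg-determined (determinedBy g eq) = determinedBy (not ∘ g) (λ vp vt → cong not (eq vp vt))

  bin-determined : ∀ o {x y} → Determined D x → Determined D y → Determined D (bin o x y)
  bin-determined o (determinedBy g eq) (determinedBy g' eq') =
    determinedBy (λ v → ⟦ o ⟧op (g v) (g' v)) (λ vp vt → cong₂ ⟦ o ⟧op (eq vp vt) (eq' vp vt))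

  ∼-determined : ∀ {x y} → x ∼ y → Determined D y → Determined D x
  ∼-determined x∼y (determinedBy g eq) = determinedBy g (λ vp vt → trans (x∼y vp vt) (eq vp vt))

  ∈⇒determined : ∀ {x} → x ∈ᵥ D → Determined D x
  ∈⇒determined {x} x∈D = determinedBy (λ v → lookup v i) λ vp vt → begin
      evalB vp vt x                                  ≡⟨ cong (evalB vp vt) (lookup-index x∈D) ⟩
      evalB vp vt (lookup D i)                       ≡⟨ lookup∘tabulate (evalB vp vt ∘ lookup D) i ⟨
      lookup (valuation D vp vt) i                   ∎
    where i = VecAny.index x∈D

decisionFormula : {P : Set} {n : ℕ} → Vec (Formula P) n → TruthTable n → Formula P
decisionFormula []      b         = if b then tt else ff
decisionFormula (d ∷ D) (t₁ , t₂) =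
  bin orOp (bin andOp d (decisionFormula D t₁)) (bin andOp (neg d) (decisionFormula D t₂))

if-as-∨∧ : ∀ x a b →
           ⟦ orOp ⟧op (⟦ andOp ⟧op x a) (⟦ andOp ⟧op (not x) b) ≡ (if x then a else b)
if-as-∨∧ true  true  true  = refl
if-as-∨∧ true  true  false = refl
if-as-∨∧ true  false true  = refl
if-as-∨∧ true  false false = refl
if-as-∨∧ false true  true  = refl
if-as-∨∧ false true  false = refl
if-as-∨∧ false false true  = refl
if-as-∨∧ false false false = refl

evalB-decisionFormula : {P : Set} {n : ℕ} (D : Vec (Formula P) n) (t : TruthTable n) → ∀ vp vt →
                        evalB vp vt (decisionFormula D t) ≡ evalTT t (valuation D vp vt)
evalB-decisionFormula []      true      vp vt = refl
evalB-decisionFormula []      false     vp vt = refl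
evalB-decisionFormula (d ∷ D) (t₁ , t₂) vp vt =
  trans (cong₂ (λ a b → ⟦ orOp ⟧op (⟦ andOp ⟧op x a) (⟦ andOp ⟧op (not x) b))
               (evalB-decisionFormula D t₁ vp vt) (evalB-decisionFormula D t₂ vp vt))
        (if-as-∨∧ x _ _)
  where x = evalB vp vt d

determined⇒∼decisionFormula : {P : Set} {n : ℕ} {D : Vec (Formula P) n} {x : Formula P} →
  (d : Determined D x) → x ∼ decisionFormula D (truthTable (Determined.truthFunction d))
determined⇒∼decisionFormula {D = D} {x} (determinedBy g eq) vp vt = begin
  evalB vp vt x                                   ≡⟨ eq vp vt ⟩
  g (valuation D vp vt)                           ≡⟨ evalTT-truthTable g (valuation D vp vt) ⟨
  evalTT (truthTable g) (valuation D vp vt)       ≡⟨ evalB-decisionFormula D (truthTable g) vp vt ⟨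
  evalB vp vt (decisionFormula D (truthTable g))  ∎

SubformulaClosed : {P : Set} {n : ℕ} → Vec (Formula P) n → Set
SubformulaClosed D = ∀ {x} → x ∈ᵥ D → All (_∈ᵥ D) (sfList x)

module Progression {P : Set} (rep : Formula P → Formula P) (rep-∼ : ∀ φ → rep φ ∼ φ) where
  open Prog rep

  progressed : (P → Bool) → (P → Bool) → (Formula P → Bool) → Formula P → Bool
  progressed w vp vt ψ = evalB vp vt (proj₁ (fp ψ w))

  evalB-fp : ∀ ψ w vp vt → evalB vp vt (proj₁ (fp ψ w)) ≡ evalB w (progressed w vp vt) ψ
  evalB-fp tt          w vp vt = refl
  evalB-fp ff          w vp vt = refl
  evalB-fp (prop p)    w vp vt with w p
  ... | true  = refl
  ... | false = refl
  evalB-fp (neg ψ)     w vp vt = trans (rep-∼ _ vp vt) (cong not (evalB-fp ψ w vp vt))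
  evalB-fp (bin o ψ χ) w vp vt =
    trans (rep-∼ _ vp vt) (cong₂ ⟦ o ⟧op (evalB-fp ψ w vp vt) (evalB-fp χ w vp vt))
  evalB-fp (X ψ)       w vp vt = refl
  evalB-fp (Xs ψ)      w vp vt = refl
  evalB-fp (F ψ)       w vp vt = refl
  evalB-fp (G ψ)       w vp vt = refl
  evalB-fp (U ψ χ)     w vp vt = refl
  evalB-fp (R ψ χ)     w vp vt = refl

  module _ {n : ℕ} {D : Vec (Formula P) n} where

    rep-determined : ∀ {x} → Determined D x → Determined D (rep x)
    rep-determined = ∼-determined (rep-∼ _)

    _∧ᵈ_ : ∀ {x y} → Determined D x → Determined D y → Determined D (rep (bin andOp x y))
    dx ∧ᵈ dy = rep-determined (bin-determined andOp dx dy)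

    _∨ᵈ_ : ∀ {x y} → Determined D x → Determined D y → Determined D (rep (bin orOp x y))
    dx ∨ᵈ dy = rep-determined (bin-determined orOp dx dy)

    fp-determined : ∀ ψ → All (_∈ᵥ D) (sfList ψ) → ∀ w → Determined D (proj₁ (fp ψ w))
    fp-determined tt          _ w = tt-determined
    fp-determined ff          _ w = ff-determined
    fp-determined (prop p)    _ w with w p
    ... | true  = tt-determined
    ... | false = ff-determined
    fp-determined (neg ψ)     (_ ∷ sf) w = rep-determined (neg-determined (fp-determined ψ sf w))
    fp-determined (bin o ψ χ) (_ ∷ sf) w = rep-determined (bin-determined o
      (fp-determined ψ (++⁻ˡ (sfList ψ) sf) w) (fp-determined χ (++⁻ʳ (sfList ψ) sf) w))
    fp-determined (X ψ)       (_ ∷ sf) w = ∈⇒determined (All.lookup sf (sfList-self ψ))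
    fp-determined (Xs ψ)      (_ ∷ sf) w = ∈⇒determined (All.lookup sf (sfList-self ψ))
    fp-determined (F ψ)       (Fψ ∷ sf) w = fp-determined ψ sf w ∨ᵈ ∈⇒determined Fψ
    fp-determined (G ψ)       (Gψ ∷ sf) w = fp-determined ψ sf w ∧ᵈ ∈⇒determined Gψ
    fp-determined (U ψ χ)     (ψUχ ∷ sf) w =
      fp-determined χ (++⁻ʳ (sfList ψ) sf) w
        ∨ᵈ (fp-determined ψ (++⁻ˡ (sfList ψ) sf) w ∧ᵈ ∈⇒determined ψUχ)
    fp-determined (R ψ χ)     (ψRχ ∷ sf) w =
      fp-determined χ (++⁻ʳ (sfList ψ) sf) w
        ∧ᵈ (fp-determined ψ (++⁻ˡ (sfList ψ) sf) w ∨ᵈ ∈⇒determined ψRχ)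

    fp-preserves-determined : SubformulaClosed D → ∀ {x} → Determined D x → ∀ w →
                              Determined D (proj₁ (fp x w))
    fp-preserves-determined closed {x} (determinedBy g eq) w =
      determinedBy (λ v → g (tabulate (λ i → Determined.truthFunction (progress i) v)))
                   λ vp vt → begin
        evalB vp vt (proj₁ (fp x w))              ≡⟨ evalB-fp x w vp vt ⟩
        evalB w (progressed w vp vt) x            ≡⟨ eq w (progressed w vp vt) ⟩
        g (valuation D w (progressed w vp vt))    ≡⟨ cong g (tabulate-cong (λ i →
          trans (sym (evalB-fp (lookup D i) w vp vt)) (Determined.evalB≡ (progress i) vp vt))) ⟩
        g (tabulate (λ i → Determined.truthFunction (progress i) (valuation D vp vt))) ∎
      where
      progress : ∀ i → Determined D (proj₁ (fp (lookup D i) w))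
      progress i = fp-determined (lookup D i) (closed (∈-lookup i D)) w

    bigAnd-determined : ∀ {xs} → All (Determined D ∘ proj₁) xs → Determined D (proj₁ (bigAnd xs))
    bigAnd-determined []                 = tt-determined
    bigAnd-determined (dx ∷ [])          = dx
    bigAnd-determined (dx ∷ dy ∷ dxs)    = bin-determined andOp dx (bigAnd-determined (dy ∷ dxs))

module _ {ko ku : ℕ} (rep : Formula (Prop ko ku) → Formula (Prop ko ku))
         (rep-∼ : ∀ φ → rep φ ∼ φ)
         {n : ℕ} {D : Vec (Formula (Prop ko ku)) n} (closed : SubformulaClosed D) where
  open Prog rep using (fp)
  open Obs rep
  open Progression rep rep-∼

  fpObs-determined : ∀ {x} → Determined D x → ∀ a → Determined D (proj₁ (fpObs x a))
  fpObs-determined {x} dx a =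
    bigAnd-determined (map⁺ (universal progress (allAssign ku)))
    where
    progress : ∀ wu → Determined D (proj₁ (fp x [ a , wu ]))
    progress wu = fp-preserves-determined closed dx [ a , wu ]

  fpObsW-determined : ∀ {x} → Determined D x → ∀ a σ → Determined D (proj₁ (fpObsW x a σ))
  fpObsW-determined dx a []      = fpObs-determined dx a
  fpObsW-determined dx a (b ∷ σ) = fpObsW-determined (fpObs-determined dx a) b σ

representatives : {P : Set} {n : ℕ} → (Formula P → Formula P) → Vec (Formula P) n → List (Formula P)
representatives {n = n} rep D = map (rep ∘ decisionFormula D) (allTruthTables n)

length-representatives : {P : Set} {n : ℕ} (rep : Formula P → Formula P) (D : Vec (Formula P) n) →
                         length (representatives rep D) ≡ 2 ^ 2 ^ n
length-representatives {n = n} rep D =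
  trans (length-map (rep ∘ decisionFormula D) (allTruthTables n)) (length-allTruthTables n)

rep-∈-representatives : {P : Set} {n : ℕ} {rep : Formula P → Formula P} {D : Vec (Formula P) n} →
                        IsRep rep → ∀ {x} → Determined D x → rep x ∈ representatives rep D
rep-∈-representatives {rep = rep} {D} isRep {x} dx =
  subst (_∈ representatives rep D) (sym (IsRep.rep-unique isRep x _ (determined⇒∼decisionFormula dx)))
        (∈-map⁺ (rep ∘ decisionFormula D) (∈-allTruthTables _))

InS⊆representatives : {ko ku n : ℕ} {rep : Formula (Prop ko ku) → Formula (Prop ko ku)}
                      {D : Vec (Formula (Prop ko ku)) n} → IsRep rep → SubformulaClosed D →
                      ∀ {φ s} → φ ∈ᵥ D → Obs.InS rep φ s → s ∈ representatives rep D
InS⊆representatives isRep closed φ∈D (inj₁ refl) =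
  rep-∈-representatives isRep (∈⇒determined φ∈D)
InS⊆representatives {rep = rep} isRep closed φ∈D (inj₂ (a , σ , refl)) =
  rep-∈-representatives isRep
    (fpObsW-determined rep (IsRep.rep-∼ isRep) closed (∈⇒determined φ∈D) a σ)

sfVec : {ko ku : ℕ} (φ : Formula (Prop ko ku)) → Vec (Formula (Prop ko ku)) (nsf φ)
sfVec φ = fromList (deduplicateᵇ (eqF eqProp) (sfList φ))

∈-sfVec⁺ : {ko ku : ℕ} (φ : Formula (Prop ko ku)) {ψ : Formula (Prop ko ku)} →
           ψ ∈ sfList φ → ψ ∈ᵥ sfVec φ
-- deduplication drops an element only if an eqF-equal, hence identical, one is kept
∈-sfVec⁺ φ ψ∈φ = ∈-fromList⁺
  (SetoidMembership.∈-deduplicate⁺ (setoid _) (λ x y → T? (eqF eqProp x y))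
  (λ {_} {y} {z} z≈y x≡y → trans x≡y (sym (eqF-sound (λ p q → toWitness) z y z≈y))) ψ∈φ)

sfVec-closed : {ko ku : ℕ} (φ : Formula (Prop ko ku)) → SubformulaClosed (sfVec φ)
sfVec-closed φ ψ∈D =
  All.tabulate (∈-sfVec⁺ φ ∘ sfList-trans φ (∈-deduplicate⁻ _ (sfList φ) (∈-fromList⁻ ψ∈D)))

theorem2 : ∃[ C ] ∀ (ko ku : ℕ)
    (rep : Formula (Prop ko ku) → Formula (Prop ko ku)) → IsRep rep →
    ∀ (φ : Formula (Prop ko ku)) →
    ∃[ L ] ((length L ≤ C * 2 ^ (2 ^ nsf φ))
    × (∀ s → Obs.InS rep φ s → s ∈ L))
theorem2 = 1 , λ ko ku rep isRep φ →
  representatives rep (sfVec φ) ,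
  ≤-reflexive (trans (length-representatives rep (sfVec φ)) (sym (*-identityˡ _))) ,
  λ s → InS⊆representatives isRep (sfVec-closed φ) (∈-sfVec⁺ φ (sfList-self φ))
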